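{- Let $s\in\mathbb{N}$, let $a_1,\ldots,a_s$ be non-zero integers, and let $P$ be an integer polynomial of positive degree. Consider the equation $a_1P(x_1)+\cdots+a_sP(x_s)=0$. (I) If this equation is partition regular, then there exists a non-empty set $I\subseteq\{1,\ldots,s\}$ with $\sum_{i\in I}a_i=0$. (II) If this equation is density regular, then $a_1+\cdots+a_s=0$.
   Context: A solution $(x_1,\ldots,x_s)$ is non-constant if $x_i\neq x_j$ for some $i\neq j$. An equation is partition regular if for every finite colouring of the positive integers there is a monochromatic non-constant solution. It is density regular if every set $A\subseteq\mathbb{N}$ with $\limsup_{N\to\infty}|A\cap\{1,\ldots,N\}|/N>0$ contains a non-constant solution (all $x_i\in A$). -}

module Defs where

open import Data.Nat using (ℕ; zero; suc; _≤_; _*_)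
open import Data.Integer using (ℤ; +_; _+_; 0ℤ)
import Data.Integer as ℤ
open import Data.Fin using (Fin)
open import Data.Bool using (Bool; true; false; if_then_else_)
open import Data.List using (List; []; _∷_)
open import Data.Product using (Σ; ∃; ∃-syntax; _×_; _,_)
open import Relation.Binary.PropositionalEquality using (_≡_)
open import Relation.Nullary using (¬_)

-- Integer polynomials as coefficient lists [c₀, c₁, c₂, …] (constant term first).
Poly : Set
Poly = List ℤ

coeff : Poly → ℕ → ℤ
coeff []       _       = 0ℤ
coeff (c ∷ cs) zero    = c
coeff (c ∷ cs) (suc i) = coeff cs i

eval : Poly → ℤ → ℤ
eval []       x = 0ℤ
eval (c ∷ cs) x = c + x ℤ.* eval cs x

PositiveDegree : Poly → Set
PositiveDegree P = ∃[ i ] (1 ≤ i × ¬ (coeff P i ≡ 0ℤ))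

sumFin : (s : ℕ) → (Fin s → ℤ) → ℤ
sumFin zero    f = 0ℤ
sumFin (suc s) f = f Fin.zero + sumFin s (λ i → f (Fin.suc i))

lhs : (s : ℕ) → (Fin s → ℤ) → Poly → (Fin s → ℕ) → ℤ
lhs s a P x = sumFin s (λ i → a i ℤ.* eval P (+ x i))

IsSolution : (s : ℕ) → (Fin s → ℤ) → Poly → (Fin s → ℕ) → Set
IsSolution s a P x = ((i : Fin s) → 1 ≤ x i) × lhs s a P x ≡ 0ℤ

NonConstant : (s : ℕ) → (Fin s → ℕ) → Set
NonConstant s x = ∃[ i ] ∃[ j ] ¬ (x i ≡ x j)

PartitionRegular : (s : ℕ) → (Fin s → ℤ) → Poly → Set
PartitionRegular s a P =
  (k : ℕ) (c : ℕ → Fin k) →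
  ∃[ x ] (IsSolution s a P x × NonConstant s x × ∃[ col ] ((i : Fin s) → c (x i) ≡ col))

count : (ℕ → Bool) → ℕ → ℕ
count A zero    = 0
count A (suc N) = (if A (suc N) then 1 else 0) Data.Nat.+ count A N

-- limsup |A∩[1,N]|/N > 0  ⇔  ∃ p/q > 0 with |A∩[1,N]|/N ≥ p/q for infinitely many N
PositiveUpperDensity : (ℕ → Bool) → Set
PositiveUpperDensity A =
  ∃[ p ] ∃[ q ] (1 ≤ p × 1 ≤ q ×
    ((M : ℕ) → ∃[ N ] (M ≤ N × p * N ≤ q * count A N)))

DensityRegular : (s : ℕ) → (Fin s → ℤ) → Poly → Set
DensityRegular s a P =
  (A : ℕ → Bool) → PositiveUpperDensity A →
  ∃[ x ] (IsSolution s a P x × NonConstant s x × ((i : Fin s) → A (x i) ≡ true))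

sumOver : (s : ℕ) → (Fin s → Bool) → (Fin s → ℤ) → ℤ
sumOver s I a = sumFin s (λ i → if I i then a i else 0ℤ)

{-# OPTIONS --safe #-}
-- (II) Pick r with P(r) ≠ 0 and a modulus m > |P(r)·Σaᵢ|. The residue class of r mod m
-- has positive density, and on it aᵢP(xᵢ) ≡ aᵢP(r) (mod m), so a solution there gives
-- m ∣ P(r)·Σaᵢ, whence Σaᵢ = 0.
-- (I) Rado's argument. Take a prime p > Σ|aᵢ|, give each x up to the largest root of P its
-- own colour and colour larger x by the residue mod p of the p-free part of P(x). In a
-- monochromatic solution P(xᵢ) = p^vᵢ uᵢ with all uᵢ ≡ u ≢ 0 (mod p); dividing by the least
-- p^vᵢ and reducing mod p gives u · Σ{aᵢ : vᵢ minimal} ≡ 0, and this subsum is smaller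
-- than p in absolute value.
module Submission where

open import Defs
open import Data.Nat as ℕ using (ℕ; zero; suc; _≤_; _<_; _⊓_; _^_; _!; NonZero; z≤n; s≤s)
import Data.Nat.Properties as ℕ
import Data.Nat.Divisibility as ℕ
open import Data.Nat.Induction using (<-wellFounded)
open import Data.Nat.Primality using (Prime; euclidsLemma; prime⇒nonZero; prime⇒nonTrivial; ¬prime[1])
open import Data.Nat.Primality.Factorisation using (PrimeFactorisation; factorise)
open import Data.Nat.ListAction using (product)
open import Data.Integer as ℤ using (ℤ; +_; _+_; _*_; -_; _-_; ∣_∣; 0ℤ; _%ℕ_)
import Data.Integer.Properties as ℤ
open import Data.Integer.DivMod using (n%ℕd<d; a≡a%ℕn+[a/ℕn]*n)
open import Data.Integer.Divisibility.Signed as ℤ using (_∣_; divides; _∣?_)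
open import Data.Integer.Tactic.RingSolver using (solve-∀)
open import Data.Fin as Fin using (Fin; fromℕ<; combine)
import Data.Fin.Properties as Fin
open import Data.Bool using (Bool; true; false; if_then_else_)
open import Data.Bool.Properties using (T-≡)
open import Data.List using (allFin; _∷_; [])
open import Data.List.Relation.Unary.All as All using (_∷_)
open import Data.List.Membership.Propositional.Properties using (∈-allFin)
open import Data.List.Extrema ℕ.≤-totalOrder using (argmin; f[argmin]≤f[xs])
open import Data.Product using (∃₂; ∃-syntax; _×_; _,_; proj₁; proj₂)
open import Data.Sum using (inj₁; inj₂; [_,_]′)
open import Function using (_∘_; Equivalence)
open import Induction.WellFounded using (Acc; acc)
open import Relation.Binary.PropositionalEquality
open import Relation.Nullary using (¬_; yes; no; does; contradiction)
open import Relation.Nullary.Decidable using (isYes; dec-true; dec-false; toWitness; fromWitness)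

private
  *-distribˡ-minus : ∀ a b c → a * b - a * c ≡ a * (b - c)
  *-distribˡ-minus = solve-∀

  +-minus-interchange : ∀ a b c d → (a + c) - (b + d) ≡ (a - b) + (c - d)
  +-minus-interchange = solve-∀

sumFin-cong : ∀ s {f g : Fin s → ℤ} → (∀ i → f i ≡ g i) → sumFin s f ≡ sumFin s g
sumFin-cong zero    f≗g = refl
sumFin-cong (suc s) f≗g = cong₂ _+_ (f≗g Fin.zero) (sumFin-cong s (f≗g ∘ Fin.suc))

sumFin-*ʳ : ∀ s (f : Fin s → ℤ) k → sumFin s (λ i → f i * k) ≡ sumFin s f * k
sumFin-*ʳ zero    f k = refl
sumFin-*ʳ (suc s) f k = begin
  f Fin.zero * k + sumFin s (λ i → f (Fin.suc i) * k) ≡⟨ cong (λ t → f Fin.zero * k + t) (sumFin-*ʳ s (f ∘ Fin.suc) k) ⟩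
  f Fin.zero * k + sumFin s (f ∘ Fin.suc) * k         ≡⟨ ℤ.*-distribʳ-+ k (f Fin.zero) _ ⟨
  sumFin (suc s) f * k                                ∎
  where open ≡-Reasoning

sumFin-∣-congruence : ∀ s {d} (f g : Fin s → ℤ) → (∀ i → d ∣ f i - g i) →
                      d ∣ sumFin s f - sumFin s g
sumFin-∣-congruence zero    f g d∣f-g = divides 0ℤ refl
sumFin-∣-congruence (suc s) f g d∣f-g =
  subst (_ ∣_) (sym (+-minus-interchange (f Fin.zero) (g Fin.zero) _ _))
    (ℤ.∣m∣n⇒∣m+n (d∣f-g Fin.zero) (sumFin-∣-congruence s (f ∘ Fin.suc) (g ∘ Fin.suc) (d∣f-g ∘ Fin.suc)))

sumAbs : ∀ s → (Fin s → ℤ) → ℕ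
sumAbs zero    a = 0
sumAbs (suc s) a = ∣ a Fin.zero ∣ ℕ.+ sumAbs s (a ∘ Fin.suc)

∣sumOver∣≤sumAbs : ∀ s I (a : Fin s → ℤ) → ∣ sumOver s I a ∣ ≤ sumAbs s a
∣sumOver∣≤sumAbs zero    I a = z≤n
∣sumOver∣≤sumAbs (suc s) I a = ℕ.≤-trans (ℤ.∣i+j∣≤∣i∣+∣j∣ (if I Fin.zero then a Fin.zero else 0ℤ) _)
  (ℕ.+-mono-≤ first≤ (∣sumOver∣≤sumAbs s (I ∘ Fin.suc) (a ∘ Fin.suc)))
  where
  first≤ : ∣ (if I Fin.zero then a Fin.zero else 0ℤ) ∣ ≤ ∣ a Fin.zero ∣
  first≤ with I Fin.zero
  ... | true  = ℕ.≤-refl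
  ... | false = z≤n

d∣x∧∣x∣<d⇒x≡0 : ∀ {d x} → + d ∣ x → ∣ x ∣ < d → x ≡ 0ℤ
d∣x∧∣x∣<d⇒x≡0 {d} {x} d∣x ∣x∣<d with ∣ x ∣ ℕ.≟ 0
... | yes ∣x∣≡0 = ℤ.∣i∣≡0⇒i≡0 ∣x∣≡0
... | no  ∣x∣≢0 = contradiction (ℕ.∣⇒≤ {{ℕ.≢-nonZero ∣x∣≢0}} (ℤ.∣⇒∣ᵤ d∣x)) (ℕ.<⇒≱ ∣x∣<d)

prime∣x*u∧∤u⇒∣x : ∀ {p} x u → Prime p → + p ∣ x * u → ¬ (+ p ∣ u) → + p ∣ x
prime∣x*u∧∤u⇒∣x x u p-prime p∣xu p∤u
  with euclidsLemma ∣ x ∣ ∣ u ∣ p-prime (subst (_ ℕ.∣_) (ℤ.abs-* x u) (ℤ.∣⇒∣ᵤ p∣xu))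
... | inj₁ p∣x = ℤ.∣ᵤ⇒∣ p∣x
... | inj₂ p∣u = contradiction (ℤ.∣ᵤ⇒∣ p∣u) p∤u

%ℕ-≡⇒∣- : ∀ d .{{_ : NonZero d}} i j → i %ℕ d ≡ j %ℕ d → + d ∣ i - j
%ℕ-≡⇒∣- d i j i%d≡j%d = divides (i ℤ./ℕ d - j ℤ./ℕ d) (begin
  i - j                                                 ≡⟨ cong₂ _-_ (a≡a%ℕn+[a/ℕn]*n i d) (a≡a%ℕn+[a/ℕn]*n j d) ⟩
  (+ (i %ℕ d) + i ℤ./ℕ d * + d) - (+ (j %ℕ d) + j ℤ./ℕ d * + d) ≡⟨ cong (λ r → (+ r + i ℤ./ℕ d * + d) - (+ (j %ℕ d) + j ℤ./ℕ d * + d)) i%d≡j%d ⟩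
  (+ (j %ℕ d) + i ℤ./ℕ d * + d) - (+ (j %ℕ d) + j ℤ./ℕ d * + d) ≡⟨ cancel (+ (j %ℕ d)) (i ℤ./ℕ d) (j ℤ./ℕ d) (+ d) ⟩
  (i ℤ./ℕ d - j ℤ./ℕ d) * + d                            ∎)
  where
  open ≡-Reasoning
  cancel : ∀ r a b d → (r + a * d) - (r + b * d) ≡ (a - b) * d
  cancel = solve-∀

p-adic-decomposition : ∀ {p} → 1 < p → ∀ {y} → y ≢ 0ℤ →
                       ∃₂ λ v u → y ≡ + (p ^ v) * u × ¬ (+ p ∣ u)
p-adic-decomposition {p} p>1 {y} y≢0 = go y y≢0 (<-wellFounded ∣ y ∣)
  where
  go : ∀ y → y ≢ 0ℤ → Acc _<_ ∣ y ∣ → ∃₂ λ v u → y ≡ + (p ^ v) * u × ¬ (+ p ∣ u)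
  go y y≢0 (acc smaller) with + p ∣? y
  ... | no  p∤y = 0 , y , sym (ℤ.*-identityˡ y) , p∤y
  ... | yes (divides q y≡q*p) with go q q≢0 (smaller ∣q∣<∣y∣)
    where
    q≢0 : q ≢ 0ℤ
    q≢0 q≡0 = y≢0 (trans y≡q*p (cong (_* + p) q≡0))
    ∣q∣<∣y∣ : ∣ q ∣ < ∣ y ∣
    ∣q∣<∣y∣ = subst (∣ q ∣ <_) (sym (trans (cong ∣_∣ y≡q*p) (ℤ.abs-* q (+ p))))
                (ℕ.m<m*n ∣ q ∣ p {{ℕ.≢-nonZero (q≢0 ∘ ℤ.∣i∣≡0⇒i≡0)}} p>1)
  ... | v , u , q≡pᵛu , p∤u = suc v , u , y≡pᵛ⁺¹u , p∤u
    where
    reassoc : ∀ a u p → (a * u) * p ≡ (p * a) * u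
    reassoc = solve-∀
    y≡pᵛ⁺¹u : y ≡ + (p ^ suc v) * u
    y≡pᵛ⁺¹u = begin
      y                        ≡⟨ y≡q*p ⟩
      q * + p                  ≡⟨ cong (_* + p) q≡pᵛu ⟩
      + (p ^ v) * u * + p      ≡⟨ reassoc (+ (p ^ v)) u (+ p) ⟩
      + p * + (p ^ v) * u      ≡⟨ cong (_* u) (ℤ.pos-* p (p ^ v)) ⟨
      + (p ^ suc v) * u        ∎
      where open ≡-Reasoning

prime-above : ∀ n → ∃[ p ] (Prime p × n < p)
prime-above n = fromFactorisation (factorise (suc (n !)))
  where
  k∣n! : ∀ {k} → 1 ≤ k → k ≤ n → k ℕ.∣ n !
  k∣n! {suc k} _ k≤n = ℕ.∣-trans (ℕ.m∣m*n (k !)) (ℕ.m≤n⇒m!∣n! k≤n)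
  fromFactorisation : PrimeFactorisation (suc (n !)) → ∃[ p ] (Prime p × n < p)
  fromFactorisation record { factors = [] ; isFactorisation = 1≡n!+1 } =
    contradiction (ℕ.suc-injective 1≡n!+1) (ℕ.≢-nonZero⁻¹ (n !) {{n ℕ.!≢0}})
  fromFactorisation record { factors = q ∷ qs ; isFactorisation = n!+1≡q*qs ; factorsPrime = q-prime ∷ _ }
    with n ℕ.<? q
  ... | yes n<q = q , q-prime , n<q
  ... | no  n≮q = contradiction (subst Prime q≡1 q-prime) ¬prime[1]
    where
    q∣n!+1 : q ℕ.∣ n ! ℕ.+ 1
    q∣n!+1 = ℕ.divides (product qs) (trans (ℕ.+-comm (n !) 1) (trans n!+1≡q*qs (ℕ.*-comm q (product qs))))
    q≡1 : q ≡ 1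
    q≡1 = ℕ.∣1⇒≡1 (ℕ.∣m+n∣m⇒∣n q∣n!+1 (k∣n! (ℕ.>-nonZero⁻¹ q {{prime⇒nonZero q-prime}}) (ℕ.≮⇒≥ n≮q)))

eval-∣-congruence : ∀ P {d} x y → d ∣ x - y → d ∣ eval P x - eval P y
eval-∣-congruence []       x y d∣x-y = divides 0ℤ refl
eval-∣-congruence (c ∷ cs) x y d∣x-y =
  subst (_ ∣_) (sym (expand c x y (eval cs x) (eval cs y)))
    (ℤ.∣m∣n⇒∣m+n (ℤ.∣n⇒∣m*n x (eval-∣-congruence cs x y d∣x-y)) (ℤ.∣m⇒∣m*n (eval cs y) d∣x-y))
  where
  expand : ∀ c x y E F → (c + x * E) - (c + y * F) ≡ x * (E - F) + (x - y) * F
  expand = solve-∀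

c≢0∧∣c∣<x⇒c+x*e≢0 : ∀ {c} e {x} → c ≢ 0ℤ → ∣ c ∣ < x → c + + x * e ≢ 0ℤ
c≢0∧∣c∣<x⇒c+x*e≢0 {c} e {x} c≢0 ∣c∣<x c+x*e≡0 = c≢0 (d∣x∧∣x∣<d⇒x≡0 x∣c ∣c∣<x)
  where
  x∣c : + x ∣ c
  x∣c = ℤ.∣m+n∣n⇒∣m (subst (_ ∣_) (sym c+x*e≡0) (divides 0ℤ refl)) (ℤ.∣m⇒∣m*n e ℤ.∣-refl)

eval-eventually-nonzero : ∀ P → (∃[ i ] coeff P i ≢ 0ℤ) →
                          ∃[ B ] (∀ x → B < x → eval P (+ x) ≢ 0ℤ)
eval-eventually-nonzero []       (_ , 0≢0) = contradiction refl 0≢0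
eval-eventually-nonzero (c ∷ cs) P≢0 with c ℤ.≟ 0ℤ
... | no  c≢0 = ∣ c ∣ , λ x ∣c∣<x → c≢0∧∣c∣<x⇒c+x*e≢0 (eval cs (+ x)) c≢0 ∣c∣<x
... | yes refl with eval-eventually-nonzero cs (tail-nonzero P≢0)
  where
  tail-nonzero : ∃[ i ] coeff (0ℤ ∷ cs) i ≢ 0ℤ → ∃[ i ] coeff cs i ≢ 0ℤ
  tail-nonzero (zero  , 0≢0)  = contradiction refl 0≢0
  tail-nonzero (suc i , cᵢ≢0) = i , cᵢ≢0
...   | B , cs-nonzero = B , λ x B<x x*cs[x]≡0 →
  [ (λ +x≡0 → ℕ.n≮0 (subst (B <_) (ℤ.+-injective +x≡0) B<x)) , cs-nonzero x B<x ]′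
    (ℤ.i*j≡0⇒i≡0∨j≡0 (+ x) (trans (sym (ℤ.+-identityˡ _)) x*cs[x]≡0))

count-mono : ∀ A {N N′} → N ≤ N′ → count A N ≤ count A N′
count-mono A {N} {zero}   z≤n   = z≤n
count-mono A {N} {suc N′} N≤1+N′ with ℕ.m≤n⇒m<n∨m≡n N≤1+N′
... | inj₂ refl      = ℕ.≤-refl
... | inj₁ (s≤s N≤N′) = ℕ.≤-trans (count-mono A N≤N′) (ℕ.m≤n+m (count A N′) _)

count-< : ∀ A {N x N′} → N < x → x ≤ N′ → A x ≡ true → count A N < count A N′
count-< A {N′ = zero}   () z≤n Ax
count-< A {N′ = suc N′} N<x x≤1+N′ Ax with ℕ.m≤n⇒m<n∨m≡n x≤1+N′
... | inj₂ refl rewrite Ax = s≤s (count-mono A (ℕ.<⇒≤pred N<x))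
... | inj₁ (s≤s x≤N′)      = ℕ.≤-trans (count-< A N<x x≤N′ Ax) (ℕ.m≤n+m (count A N′) _)

positiveUpperDensity-blocks : ∀ A m .{{_ : NonZero m}} →
  (∀ k → ∃[ x ] (m ℕ.* k < x × x ≤ m ℕ.* suc k × A x ≡ true)) → PositiveUpperDensity A
positiveUpperDensity-blocks A m hits =
  1 , m , ℕ.≤-refl , ℕ.>-nonZero⁻¹ m , λ k → m ℕ.* k , ℕ.m≤n*m k m ,
    subst (ℕ._≤ m ℕ.* count A (m ℕ.* k)) (sym (ℕ.*-identityˡ (m ℕ.* k))) (ℕ.*-monoʳ-≤ m (k≤count k))
  where
  k≤count : ∀ k → k ≤ count A (m ℕ.* k)
  k≤count zero    = z≤n
  k≤count (suc k) with hits k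
  ... | x , mk<x , x≤m[k+1] , Ax = ℕ.≤-<-trans (k≤count k) (count-< A mk<x x≤m[k+1] Ax)

residueClass : ℕ → ℕ → ℕ → Bool
residueClass m r x = isYes (+ m ∣? + r - + x)

residueClass⇒∣ : ∀ m r x → residueClass m r x ≡ true → + m ∣ + r - + x
residueClass⇒∣ m r x x∈A = toWitness (Equivalence.from T-≡ x∈A)

residueClass-positiveUpperDensity : ∀ m r → 1 ≤ r → r ≤ m → PositiveUpperDensity (residueClass m r)
residueClass-positiveUpperDensity m r 1≤r r≤m =
  positiveUpperDensity-blocks (residueClass m r) m {{ℕ.>-nonZero (ℕ.≤-trans 1≤r r≤m)}} λ k →
    m ℕ.* k ℕ.+ r ,
    ℕ.m<m+n (m ℕ.* k) 1≤r ,
    subst (m ℕ.* k ℕ.+ r ≤_) (trans (ℕ.+-comm (m ℕ.* k) m) (sym (ℕ.*-suc m k))) (ℕ.+-monoʳ-≤ (m ℕ.* k) r≤m) ,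
    Equivalence.to T-≡ (fromWitness (divides (- + k) (begin
      + r - + (m ℕ.* k ℕ.+ r)       ≡⟨ cong (λ t → + r - t) (trans (ℤ.pos-+ (m ℕ.* k) r) (cong (_+ + r) (ℤ.pos-* m k))) ⟩
      + r - (+ m * + k + + r)       ≡⟨ shift (+ r) (+ m) (+ k) ⟩
      - + k * + m                   ∎)))
  where
  open ≡-Reasoning
  shift : ∀ r m k → r - (m * k + r) ≡ - k * m
  shift = solve-∀

residueClass-solution⇒∣ : ∀ s (a : Fin s → ℤ) P m r (x : Fin s → ℕ) →
  (∀ i → residueClass m r (x i) ≡ true) → lhs s a P x ≡ 0ℤ →
  + m ∣ sumFin s a * eval P (+ r)
residueClass-solution⇒∣ s a P m r x x∈A lhs≡0 =
  subst (+ m ∣_) (trans (cong₂ _-_ (sumFin-*ʳ s a (eval P (+ r))) lhs≡0) (ℤ.+-identityʳ _))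
    (sumFin-∣-congruence s (λ i → a i * eval P (+ r)) (λ i → a i * eval P (+ x i)) termwise)
  where
  termwise : ∀ i → + m ∣ a i * eval P (+ r) - a i * eval P (+ x i)
  termwise i = subst (+ m ∣_) (sym (*-distribˡ-minus (a i) _ _))
    (ℤ.∣n⇒∣m*n (a i) (eval-∣-congruence P (+ r) (+ x i) (residueClass⇒∣ m r (x i) (x∈A i))))

densityRegular⇒sum≡0 : ∀ s (a : Fin s → ℤ) P → (∃[ i ] coeff P i ≢ 0ℤ) →
                       DensityRegular s a P → sumFin s a ≡ 0ℤ
densityRegular⇒sum≡0 s a P P≢0 DR =
  [ (λ S≡0 → S≡0) , (λ P[r]≡0 → contradiction P[r]≡0 P[r]≢0) ]′ (ℤ.i*j≡0⇒i≡0∨j≡0 (sumFin s a) S*P[r]≡0)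
  where
  r : ℕ
  r = suc (proj₁ (eval-eventually-nonzero P P≢0))
  P[r]≢0 : eval P (+ r) ≢ 0ℤ
  P[r]≢0 = proj₂ (eval-eventually-nonzero P P≢0) r (ℕ.n<1+n _)
  m : ℕ
  m = ∣ sumFin s a * eval P (+ r) ∣ ℕ.+ r
  solutionInClass : ∃[ x ] (IsSolution s a P x × NonConstant s x × (∀ i → residueClass m r (x i) ≡ true))
  solutionInClass = DR (residueClass m r) (residueClass-positiveUpperDensity m r (s≤s z≤n) (ℕ.m≤n+m r _))
  S*P[r]≡0 : sumFin s a * eval P (+ r) ≡ 0ℤ
  S*P[r]≡0 with solutionInClass
  ... | x , (_ , lhs≡0) , _ , x∈A =
    d∣x∧∣x∣<d⇒x≡0 (residueClass-solution⇒∣ s a P m r x x∈A lhs≡0) (ℕ.m<m+n _ (s≤s z≤n))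

minValuation-∣ : ∀ s (a : Fin s → ℤ) p .{{_ : NonZero p}} (v : Fin s → ℕ) (u : Fin s → ℤ) i₀ →
  (∀ j → v i₀ ≤ v j) → (∀ j → + p ∣ u i₀ - u j) →
  sumFin s (λ i → a i * (+ (p ^ v i) * u i)) ≡ 0ℤ →
  + p ∣ sumOver s (λ i → does (v i ℕ.≟ v i₀)) a * u i₀
minValuation-∣ s a p v u i₀ v₀-min u₀≡u relation =
  subst (+ p ∣_) (trans (cong₂ _-_ (sumFin-*ʳ s g (u i₀)) Σaw≡0) (ℤ.+-identityʳ _))
    (sumFin-∣-congruence s (λ i → g i * u i₀) (λ i → a i * w i) termwise)
  where
  g : Fin s → ℤ
  g i = if does (v i ℕ.≟ v i₀) then a i else 0ℤ
  w : Fin s → ℤ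
  w i = + (p ^ (v i ℕ.∸ v i₀)) * u i

  factor : ∀ i → a i * (+ (p ^ v i) * u i) ≡ a i * w i * + (p ^ v i₀)
  factor i = begin
    a i * (+ (p ^ v i) * u i)                                 ≡⟨ cong (λ t → a i * (+ (p ^ t) * u i)) (ℕ.m+[n∸m]≡n (v₀-min i)) ⟨
    a i * (+ (p ^ (v i₀ ℕ.+ (v i ℕ.∸ v i₀))) * u i)           ≡⟨ cong (λ t → a i * (+ t * u i)) (ℕ.^-distribˡ-+-* p (v i₀) _) ⟩
    a i * (+ (p ^ v i₀ ℕ.* p ^ (v i ℕ.∸ v i₀)) * u i)         ≡⟨ cong (λ t → a i * (t * u i)) (ℤ.pos-* (p ^ v i₀) _) ⟩
    a i * (+ (p ^ v i₀) * + (p ^ (v i ℕ.∸ v i₀)) * u i)       ≡⟨ reassoc (a i) (+ (p ^ v i₀)) _ (u i) ⟩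
    a i * w i * + (p ^ v i₀)                                  ∎
    where
    open ≡-Reasoning
    reassoc : ∀ a A D u → a * (A * D * u) ≡ a * (D * u) * A
    reassoc = solve-∀

  Σaw≡0 : sumFin s (λ i → a i * w i) ≡ 0ℤ
  Σaw≡0 = ℤ.*-cancelʳ-≡ _ 0ℤ (+ (p ^ v i₀)) {{ℕ.m^n≢0 p (v i₀)}}
    (trans (sym (sumFin-*ʳ s (λ i → a i * w i) _)) (trans (sumFin-cong s (sym ∘ factor)) relation))

  p∣pᵈ : ∀ {d} → 0 < d → + p ∣ + (p ^ d)
  p∣pᵈ {suc d} _ = ℤ.∣ᵤ⇒∣ (ℕ.m∣m*n (p ^ d))

  termwise : ∀ i → + p ∣ g i * u i₀ - a i * w i
  termwise i with v i ℕ.≟ v i₀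
  ... | yes vᵢ≡v₀ rewrite dec-true (v i ℕ.≟ v i₀) vᵢ≡v₀ = subst (+ p ∣_) (sym (*-distribˡ-minus (a i) (u i₀) (w i)))
          (ℤ.∣n⇒∣m*n (a i) (subst (λ t → + p ∣ u i₀ - t) (sym wᵢ≡uᵢ) (u₀≡u i)))
    where
    wᵢ≡uᵢ : w i ≡ u i
    wᵢ≡uᵢ = trans (cong (λ t → + (p ^ t) * u i) (trans (cong (ℕ._∸ v i₀) vᵢ≡v₀) (ℕ.n∸n≡0 (v i₀))))
                  (ℤ.*-identityˡ (u i))
  ... | no  vᵢ≢v₀ rewrite dec-false (v i ℕ.≟ v i₀) vᵢ≢v₀ = subst (+ p ∣_) (sym (ℤ.+-identityˡ _))
          (ℤ.∣m⇒∣-m (ℤ.∣n⇒∣m*n (a i) (ℤ.∣m⇒∣m*n (u i) (p∣pᵈ (ℕ.m<n⇒0<n∸m v₀<vᵢ)))))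
    where
    v₀<vᵢ : v i₀ < v i
    v₀<vᵢ = ℕ.≤∧≢⇒< (v₀-min i) (vᵢ≢v₀ ∘ sym)

p-adic-relation⇒zeroSubsum : ∀ s (a : Fin s → ℤ) {p} → Prime p → sumAbs s a < p →
  (v : Fin s → ℕ) (u : Fin s → ℤ) → (∀ i → ¬ (+ p ∣ u i)) → (∀ i j → + p ∣ u i - u j) →
  sumFin s (λ i → a i * (+ (p ^ v i) * u i)) ≡ 0ℤ → Fin s →
  ∃[ I ] ((∃[ i ] (I i ≡ true)) × sumOver s I a ≡ 0ℤ)
p-adic-relation⇒zeroSubsum s a {p} p-prime Σ∣a∣<p v u p∤u u≡u relation i =
  I , (i₀ , dec-true (v i₀ ℕ.≟ v i₀) refl) ,
  d∣x∧∣x∣<d⇒x≡0 p∣ΣI (ℕ.≤-<-trans (∣sumOver∣≤sumAbs s I a) Σ∣a∣<p)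
  where
  instance
    p≢0 : NonZero p
    p≢0 = prime⇒nonZero p-prime
  i₀ : Fin s
  i₀ = argmin v i (allFin s)
  v₀-min : ∀ j → v i₀ ≤ v j
  v₀-min j = All.lookup (f[argmin]≤f[xs] i (allFin s)) (∈-allFin j)
  I : Fin s → Bool
  I j = does (v j ℕ.≟ v i₀)
  p∣ΣI : + p ∣ sumOver s I a
  p∣ΣI = prime∣x*u∧∤u⇒∣x _ (u i₀) p-prime (minValuation-∣ s a p v u i₀ v₀-min (u≡u i₀) relation) (p∤u i₀)

-- The p-free part of y; the junk value 0 at y = 0 is never inspected.
unitPart : ∀ {p} → 1 < p → ℤ → ℤ
unitPart p>1 y with y ℤ.≟ 0ℤ
... | yes _   = 0ℤ
... | no  y≢0 = proj₁ (proj₂ (p-adic-decomposition p>1 y≢0))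

unitPart-spec : ∀ {p} (p>1 : 1 < p) {y} → y ≢ 0ℤ →
                ∃[ v ] (y ≡ + (p ^ v) * unitPart p>1 y × ¬ (+ p ∣ unitPart p>1 y))
unitPart-spec p>1 {y} y≢0 with y ℤ.≟ 0ℤ
... | yes y≡0  = contradiction y≡0 y≢0
... | no  y≢0′ with p-adic-decomposition p>1 y≢0′
...   | v , _ , y≡pᵛu , p∤u = v , y≡pᵛu , p∤u

⊓-suc-injective-below : ∀ {B x y} → x ≤ B → x ⊓ suc B ≡ y ⊓ suc B → x ≡ y
⊓-suc-injective-below {B} {x} {y} x≤B x⊓≡y⊓ with ℕ.⊓-sel y (suc B)
... | inj₁ y⊓≡y  = trans x≡x⊓ (trans x⊓≡y⊓ y⊓≡y)
  where
  x≡x⊓ : x ≡ x ⊓ suc B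
  x≡x⊓ = sym (ℕ.m≤n⇒m⊓n≡m (ℕ.m≤n⇒m≤1+n x≤B))
... | inj₂ y⊓≡1+B = contradiction (subst (_≤ B) x≡1+B x≤B) ℕ.1+n≰n
  where
  x≡1+B : x ≡ suc B
  x≡1+B = trans (sym (ℕ.m≤n⇒m⊓n≡m (ℕ.m≤n⇒m≤1+n x≤B))) (trans x⊓≡y⊓ y⊓≡1+B)

module UnitResidueColouring (P : Poly) (B : ℕ) {p} (p-prime : Prime p) where

  instance
    p≢0 : NonZero p
    p≢0 = prime⇒nonZero p-prime

  p>1 : 1 < p
  p>1 = ℕ.nonTrivial⇒n>1 p {{prime⇒nonTrivial p-prime}}

  unit : ℕ → ℤ
  unit x = unitPart p>1 (eval P (+ x))

  threshold : ℕ → Fin (suc (suc B))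
  threshold x = fromℕ< (s≤s (ℕ.m⊓n≤n x (suc B)))

  residue : ℕ → Fin p
  residue x = fromℕ< (n%ℕd<d (unit x) p)

  colour : ℕ → Fin (suc (suc B) ℕ.* p)
  colour x = combine (threshold x) (residue x)

  colour-≡⇒≡-below : ∀ {x y} → colour x ≡ colour y → x ≤ B → x ≡ y
  colour-≡⇒≡-below {x} {y} same x≤B = ⊓-suc-injective-below x≤B
    (Fin.fromℕ<-injective _ _ _ _ (Fin.combine-injectiveˡ (threshold x) (residue x) (threshold y) (residue y) same))

  colour-≡⇒unit-∣ : ∀ {x y} → colour x ≡ colour y → + p ∣ unit x - unit y
  colour-≡⇒unit-∣ {x} {y} same = %ℕ-≡⇒∣- p (unit x) (unit y)
    (Fin.fromℕ<-injective _ _ _ _ (Fin.combine-injectiveʳ (threshold x) (residue x) (threshold y) (residue y) same))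

  monochromatic⇒zeroSubsum : ∀ s (a : Fin s → ℤ) → (∀ x → B < x → eval P (+ x) ≢ 0ℤ) →
    sumAbs s a < p → ∀ x → lhs s a P x ≡ 0ℤ → NonConstant s x →
    (∀ i j → colour (x i) ≡ colour (x j)) →
    ∃[ I ] ((∃[ i ] (I i ≡ true)) × sumOver s I a ≡ 0ℤ)
  monochromatic⇒zeroSubsum s a P[x]≢0 Σ∣a∣<p x lhs≡0 (i₀ , j₀ , xᵢ₀≢xⱼ₀) same =
    p-adic-relation⇒zeroSubsum s a p-prime Σ∣a∣<p v (unit ∘ x) p∤u
      (λ i j → colour-≡⇒unit-∣ (same i j)) relation i₀
    where
    large : ∀ i → B < x i
    large i with x i ℕ.≤? B
    ... | no  xᵢ≰B = ℕ.≰⇒> xᵢ≰B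
    ... | yes xᵢ≤B = contradiction (trans (sym (xᵢ≡ i₀)) (xᵢ≡ j₀)) xᵢ₀≢xⱼ₀
      where
      xᵢ≡ : ∀ j → x i ≡ x j
      xᵢ≡ j = colour-≡⇒≡-below (same i j) xᵢ≤B
    decomposition : ∀ i → ∃[ v ] (eval P (+ x i) ≡ + (p ^ v) * unit (x i) × ¬ (+ p ∣ unit (x i)))
    decomposition i = unitPart-spec p>1 (P[x]≢0 (x i) (large i))
    v : Fin s → ℕ
    v i = proj₁ (decomposition i)
    p∤u : ∀ i → ¬ (+ p ∣ unit (x i))
    p∤u i = proj₂ (proj₂ (decomposition i))
    relation : sumFin s (λ i → a i * (+ (p ^ v i) * unit (x i))) ≡ 0ℤ
    relation = trans (sumFin-cong s (λ i → cong (a i *_) (sym (proj₁ (proj₂ (decomposition i)))))) lhs≡0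

partitionRegular⇒zeroSubsum : ∀ s (a : Fin s → ℤ) P → (∃[ i ] coeff P i ≢ 0ℤ) →
  PartitionRegular s a P → ∃[ I ] ((∃[ i ] (I i ≡ true)) × sumOver s I a ≡ 0ℤ)
partitionRegular⇒zeroSubsum s a P P≢0 PR =
  let (B , P[x]≢0)             = eval-eventually-nonzero P P≢0
      (p , p-prime , Σ∣a∣<p)   = prime-above (sumAbs s a)
      open UnitResidueColouring P B p-prime
      (x , (_ , lhs≡0) , nonconstant , _ , monochromatic) = PR _ colour
  in monochromatic⇒zeroSubsum s a P[x]≢0 Σ∣a∣<p x lhs≡0 nonconstant
       (λ i j → trans (monochromatic i) (sym (monochromatic j)))

proposition2p1 : (s : ℕ) (a : Fin s → ℤ) (P : Poly) →
    ((i : Fin s) → ¬ (a i ≡ 0ℤ)) → PositiveDegree P →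
    (PartitionRegular s a P →
      ∃[ I ] ((∃[ i ] (I i ≡ true)) × sumOver s I a ≡ 0ℤ))
    × (DensityRegular s a P → sumFin s a ≡ 0ℤ)
proposition2p1 s a P _ (i , _ , cᵢ≢0) =
  partitionRegular⇒zeroSubsum s a P (i , cᵢ≢0) , densityRegular⇒sum≡0 s a P (i , cᵢ≢0)
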